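{- Let $r$ be the row reading word of a standard tableau. If $w$ is a permutation which is related to $r$ by one proper $K_1$ move or one proper $K_2$ move, then $w$ has steady-state time $1$.
   Context: The row reading word of a tableau (English notation) is the concatenation of its rows from bottom to top, each read left to right. Knuth moves on $S_n$, with $x<y<z$: a $K_1$ move relates $\cdots yxz\cdots$ and $\cdots yzx\cdots$; a $K_2$ move relates $\cdots xzy\cdots$ and $\cdots zxy\cdots$ (same entries elsewhere). A $K_B$ move relates $\cdots y_1xzy_2\cdots$ and $\cdots y_1zxy_2\cdots$ with $x<y_1<z$ and $x<y_2<z$. A proper $K_1$ (resp. $K_2$) move is a $K_1$ (resp. $K_2$) move that is not a $K_B$ move. Box-ball system (BBS): boxes in a row extending infinitely to the right, each holding at most one ball, balls labeled $1,\dots,n$. A permutation $w=w_1\cdots w_n$ gives the time-$0$ configuration with ball $w_i$ in the $i$-th of $n$ consecutive boxes. A BBS move moves ball $1$ to the nearest empty box to its right, then ball $2$, ..., then ball $n$; the state at time $t$ is obtained after $t$ moves. An increasing run is a maximal block of balls in consecutive boxes with labels increasing left to right; a soliton is an increasing run preserved by all subsequent BBS moves (its balls stay consecutive and in order, and the runs keep their relative order). A configuration is in steady state if all its increasing runs are solitons. The steady-state time of $w$ is the least $t\ge0$ such that the state at time $t$ is in steady state. -}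

module Defs where

open import Data.Nat using (ℕ; zero; suc; _<_; _≤_; _<ᵇ_; _≡ᵇ_)
open import Data.Bool using (Bool; true; false; if_then_else_)
open import Data.Maybe using (Maybe; just; nothing)
open import Data.List using (List; []; _∷_; _++_; length; map; concat; reverse; upTo; foldl)
open import Data.List.Relation.Unary.All using (All)
open import Data.List.Relation.Unary.Linked using (Linked)
open import Data.List.Relation.Binary.Permutation.Propositional using (_↭_)
open import Data.Product using (_×_; _,_; proj₁; proj₂; ∃-syntax)
open import Data.Sum using (_⊎_)
open import Data.Unit using (⊤)
open import Data.Empty using (⊥)
open import Relation.Nullary using (¬_)
open import Relation.Binary.PropositionalEquality using (_≡_)
open import Function using (_∘_)

-- Standard Young tableaux (English notation).
-- A tableau is the list of its rows, top row first.

ShapeOK : List (List ℕ) → Set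
ShapeOK [] = ⊤
ShapeOK (R ∷ []) = ⊤
ShapeOK (R ∷ R' ∷ Rs) = (length R' ≤ length R) × ShapeOK (R' ∷ Rs)

ColStrict : List ℕ → List ℕ → Set
ColStrict _ [] = ⊤
ColStrict [] (_ ∷ _) = ⊥
ColStrict (a ∷ as) (b ∷ bs) = (a < b) × ColStrict as bs

ColsOK : List (List ℕ) → Set
ColsOK [] = ⊤
ColsOK (R ∷ []) = ⊤
ColsOK (R ∷ R' ∷ Rs) = ColStrict R R' × ColsOK (R' ∷ Rs)

oneTo : ℕ → List ℕ
oneTo n = map suc (upTo n)

record StandardTableau (T : List (List ℕ)) : Set where
  field
    rowsNonEmpty : All (λ R → 0 < length R) T
    shape        : ShapeOK T
    entries      : concat T ↭ oneTo (length (concat T))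
    rowsIncr     : All (Linked _<_) T
    colsIncr     : ColsOK T

rowReading : List (List ℕ) → List ℕ
rowReading T = concat (reverse T)

K1step : List ℕ → List ℕ → Set
K1step u v = ∃[ p ] ∃[ s ] ∃[ x ] ∃[ y ] ∃[ z ]
  (x < y) × (y < z) ×
  (u ≡ p ++ y ∷ x ∷ z ∷ s) × (v ≡ p ++ y ∷ z ∷ x ∷ s)

K2step : List ℕ → List ℕ → Set
K2step u v = ∃[ p ] ∃[ s ] ∃[ x ] ∃[ y ] ∃[ z ]
  (x < y) × (y < z) ×
  (u ≡ p ++ x ∷ z ∷ y ∷ s) × (v ≡ p ++ z ∷ x ∷ y ∷ s)

KBstep : List ℕ → List ℕ → Set
KBstep u v = ∃[ p ] ∃[ s ] ∃[ x ] ∃[ y₁ ] ∃[ y₂ ] ∃[ z ]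
  (x < y₁) × (y₁ < z) × (x < y₂) × (y₂ < z) ×
  (u ≡ p ++ y₁ ∷ x ∷ z ∷ y₂ ∷ s) × (v ≡ p ++ y₁ ∷ z ∷ x ∷ y₂ ∷ s)

K1 K2 KB : List ℕ → List ℕ → Set
K1 u v = K1step u v ⊎ K1step v u
K2 u v = K2step u v ⊎ K2step v u
KB u v = KBstep u v ⊎ KBstep v u

ProperK1 ProperK2 : List ℕ → List ℕ → Set
ProperK1 u v = K1 u v × ¬ KB u v
ProperK2 u v = K2 u v × ¬ KB u v

-- Box-ball system.  A configuration is a finite list of boxes
-- (nothing = empty box, just i = ball i); all boxes beyond the end of
-- the list are empty.

Config : Set
Config = List (Maybe ℕ)

place : ℕ → Config → Config
place i [] = just i ∷ []
place i (nothing ∷ xs) = just i ∷ xs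
place i (just j ∷ xs) = just j ∷ place i xs

moveBall : ℕ → Config → Config
moveBall i [] = []
moveBall i (nothing ∷ xs) = nothing ∷ moveBall i xs
moveBall i (just j ∷ xs) =
  if j ≡ᵇ i then nothing ∷ place i xs else just j ∷ moveBall i xs

bbsMove : ℕ → Config → Config
bbsMove n c = foldl (λ d i → moveBall i d) c (oneTo n)

bbsIter : ℕ → ℕ → Config → Config
bbsIter n zero c = c
bbsIter n (suc t) c = bbsIter n t (bbsMove n c)

initConfig : List ℕ → Config
initConfig = map just

stateAt : List ℕ → ℕ → Config
stateAt w t = bbsIter (length w) t (initConfig w)

consNE : List ℕ → List (List ℕ) → List (List ℕ)
consNE [] rs = rs
consNE (a ∷ as) rs = (a ∷ as) ∷ rs

-- first component: the run starting at the first box (empty if that box is empty);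
-- second component: the runs strictly after it.
runsAux : Config → List ℕ × List (List ℕ)
runsAux [] = [] , []
runsAux (nothing ∷ xs) with runsAux xs
... | c , rs = [] , consNE c rs
runsAux (just a ∷ xs) with runsAux xs
... | [] , rs = a ∷ [] , rs
... | (b ∷ bs) , rs =
  if a <ᵇ b then (a ∷ b ∷ bs , rs) else (a ∷ [] , (b ∷ bs) ∷ rs)

increasingRuns : Config → List (List ℕ)
increasingRuns c = consNE (proj₁ (runsAux c)) (proj₂ (runsAux c))

-- A configuration (of a system with balls 1..n) is in steady state if all
-- its increasing runs are solitons: under every number of subsequent BBS
-- moves the increasing runs (as blocks of labels, in left-to-right order)
-- are unchanged.
SteadyState : ℕ → Config → Set
SteadyState n c = ∀ k → increasingRuns (bbsIter n k c) ≡ increasingRuns c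

SteadyStateTime : List ℕ → ℕ → Set
SteadyStateTime w t =
  SteadyState (length w) (stateAt w t) ×
  (∀ s → s < t → ¬ SteadyState (length w) (stateAt w s))

{-# OPTIONS --safe #-}
-- A BBS move on distinct balls is computed by a single left-to-right sweep of a carrier holding the
-- balls in transit (Takahashi–Satsuma). On a train of increasing blocks, each sitting column-strictly
-- below its weakly longer right neighbour once the gap between them is accounted for, the sweep
-- moves every block to the right by its own length: such a train is in steady state, and its
-- increasing runs stay its blocks forever. In the row reading word of a standard tableau a proper
-- K₁ or K₂ move can only permute the entry l of a one-box row with the first two entries of the next
-- row; anywhere else it is a K_B move or contradicts the tableau conditions. One sweep of the
-- perturbed word gives the train of the tableau rows with the block (l) moved one box to the right,
-- which is steady, whereas at time 0 the runs spell the perturbed word and not the reading word.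
module Submission where

open import Defs
open import Data.Nat using (ℕ; zero; suc; _+_; _∸_; _<_; _≤_; _<ᵇ_; _≡ᵇ_; z≤n; s≤s; s≤s⁻¹)
open import Data.Nat.Properties
open import Data.Bool using (Bool; true; false; if_then_else_; T)
open import Data.Maybe as Maybe using (Maybe; just; nothing)
open import Data.Maybe.Properties using (just-injective)
import Data.Maybe.Relation.Unary.All as MaybeAll
open import Data.List
  using (List; []; _∷_; _++_; length; map; concat; reverse; reverseAcc; upTo; foldl; replicate; take; drop; catMaybes; head; initLast; _∷ʳ′_)
open import Data.List.Properties
  using ( ∷-injective; ∷-injectiveˡ; ∷-injectiveʳ; ∷ʳ-injective; ++-cancelˡ; ++-assoc; ++-identityʳ; map-++; foldl-++
        ; unfold-reverse; upTo-∷ʳ; catMaybes-++; mapMaybe-just; length-drop; drop-[]; concat-++)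
open import Data.List.Relation.Unary.All as All using (All; []; _∷_)
open import Data.List.Relation.Unary.Linked as Linked using (Linked; []; [-]; _∷_)
open import Data.List.Relation.Unary.Linked.Properties using (Linked⇒All) renaming (map⁺ to Linked-map⁺)
import Data.List.Relation.Unary.All.Properties as All
open import Data.List.Relation.Unary.Unique.Propositional using (Unique; []; _∷_)
import Data.List.Relation.Unary.Unique.Propositional.Properties as Unique
open import Data.List.Relation.Binary.Permutation.Propositional
  using (_↭_; ↭-refl; ↭-prep; ↭-swap; ↭-sym; ↭-trans; ↭⇒↭ₛ; module PermutationReasoning)
open import Data.List.Relation.Binary.Permutation.Propositional.Properties
  using (All-resp-↭; ↭-reverse; ↭-length; ++⁺ˡ; ++⁺ʳ; ++-comm)
import Data.List.Relation.Binary.Permutation.Setoid.Properties as PermS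
open import Data.Product using (_×_; _,_; proj₁; proj₂; map₁; map₂; ∃-syntax)
open import Data.Sum using (_⊎_; inj₁; inj₂)
open import Data.Unit using (tt)
open import Data.Empty using (⊥-elim)
open import Relation.Nullary using (¬_; yes; no)
open import Relation.Nullary.Decidable using (dec-true; dec-false)
open import Relation.Binary.PropositionalEquality
open import Function using (_∘_; id)

<ᵇ-true : ∀ {a b} → a < b → (a <ᵇ b) ≡ true
<ᵇ-true {a} {b} = dec-true (a <? b)

<ᵇ-false : ∀ {a b} → ¬ a < b → (a <ᵇ b) ≡ false
<ᵇ-false {a} {b} = dec-false (a <? b)

≡ᵇ-false : ∀ {a b} → a ≢ b → (a ≡ᵇ b) ≡ false
≡ᵇ-false {a} {b} = dec-false (a ≟ b)

≡ᵇ-refl : ∀ a → (a ≡ᵇ a) ≡ true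
≡ᵇ-refl a = dec-true (a ≟ a) refl

-- The carrier algorithm

blank : ℕ → Config
blank g = replicate g nothing

movable : ℕ → ℕ → Bool
movable m zero = false
movable m (suc j) = j <ᵇ m

Movable : ℕ → List ℕ → Set
Movable m = All (λ b → movable m b ≡ true)

popAbove : ℕ → List ℕ → Maybe (ℕ × List ℕ)
popAbove b [] = nothing
popAbove b (a ∷ as) = if b <ᵇ a then just (a , as) else Maybe.map (map₂ (a ∷_)) (popAbove b as)

insert : ℕ → List ℕ → List ℕ
insert b [] = b ∷ []
insert b (a ∷ as) = if b <ᵇ a then b ∷ a ∷ as else a ∷ insert b as

exchange : ℕ → List ℕ → Maybe (ℕ × List ℕ) → Maybe ℕ × List ℕ
exchange b S nothing = nothing , insert b S
exchange b S (just (a , S′)) = just a , insert b S′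

-- The carrier keeps the balls in transit in increasing order.
carrierStep : ℕ → List ℕ → Maybe ℕ → Maybe ℕ × List ℕ
carrierStep m S (just b) = if movable m b then exchange b S (popAbove b S) else (just b , S)
carrierStep m [] nothing = nothing , []
carrierStep m (a ∷ S) nothing = just a , S

carry : ℕ → List ℕ → Config → Config × List ℕ
carry m S [] = [] , S
carry m S (x ∷ xs) = map₁ (proj₁ (carrierStep m S x) ∷_) (carry m (proj₂ (carrierStep m S x)) xs)

sweep : ℕ → List ℕ → Config → Config
sweep m S xs = proj₁ (carry m S xs) ++ map just (proj₂ (carry m S xs))

sweep-++ : ∀ m S xs ys → sweep m S (xs ++ ys) ≡ proj₁ (carry m S xs) ++ sweep m (proj₂ (carry m S xs)) ys
sweep-++ m S [] ys = refl
sweep-++ m S (x ∷ xs) ys = cong (_ ∷_) (sweep-++ m _ xs ys)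

carry-++ : ∀ m S xs ys →
  carry m S (xs ++ ys) ≡ ( proj₁ (carry m S xs) ++ proj₁ (carry m (proj₂ (carry m S xs)) ys)
                         , proj₂ (carry m (proj₂ (carry m S xs)) ys))
carry-++ m S [] ys = refl
carry-++ m S (x ∷ xs) ys rewrite carry-++ m (proj₂ (carrierStep m S x)) xs ys = refl

popAbove-none : ∀ {b} S → All (_≤ b) S → popAbove b S ≡ nothing
popAbove-none [] [] = refl
popAbove-none (a ∷ S) (a≤b ∷ p) rewrite <ᵇ-false (≤⇒≯ a≤b) | popAbove-none S p = refl

popAbove-first : ∀ {b c} P X → All (_≤ b) P → b < c → popAbove b (P ++ c ∷ X) ≡ just (c , P ++ X)
popAbove-first [] X [] b<c rewrite <ᵇ-true b<c = refl
popAbove-first (a ∷ P) X (a≤b ∷ p) b<c rewrite <ᵇ-false (≤⇒≯ a≤b) | popAbove-first P X p b<c = refl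

popAbove-++-just : ∀ {b a S′} S T → popAbove b S ≡ just (a , S′) → popAbove b (S ++ T) ≡ just (a , S′ ++ T)
popAbove-++-just {b} (c ∷ S) T e with b <ᵇ c | popAbove b S in eS
popAbove-++-just (c ∷ S) T refl | true | _ = refl
popAbove-++-just (c ∷ S) T refl | false | just _ rewrite popAbove-++-just S T eS = refl

popAbove-++-nothing : ∀ {b} S T → popAbove b S ≡ nothing → popAbove b (S ++ T) ≡ Maybe.map (map₂ (S ++_)) (popAbove b T)
popAbove-++-nothing {b} [] T _ with popAbove b T
... | nothing = refl
... | just _ = refl
popAbove-++-nothing {b} (c ∷ S) T e with b <ᵇ c | popAbove b S in eS
popAbove-++-nothing (c ∷ S) T () | true | _
popAbove-++-nothing {b} (c ∷ S) T refl | false | nothing rewrite popAbove-++-nothing S T eS with popAbove b T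
... | nothing = refl
... | just _ = refl

popAbove-All : ∀ {P : ℕ → Set} {b a S′} S → All P S → popAbove b S ≡ just (a , S′) → P a × All P S′
popAbove-All {b = b} (c ∷ S) (pc ∷ p) e with b <ᵇ c | popAbove b S in eS
popAbove-All (c ∷ S) (pc ∷ p) refl | true | _ = pc , p
popAbove-All (c ∷ S) (pc ∷ p) refl | false | just _ = map₂ (pc ∷_) (popAbove-All S p eS)

insert-least : ∀ {b} X → All (b <_) X → insert b X ≡ b ∷ X
insert-least [] _ = refl
insert-least (c ∷ X) (b<c ∷ _) rewrite <ᵇ-true b<c = refl

insert-++ʳ : ∀ {b} P X → All (_< b) P → insert b (P ++ X) ≡ P ++ insert b X
insert-++ʳ [] X [] = refl
insert-++ʳ (a ∷ P) X (a<b ∷ p) rewrite <ᵇ-false (<⇒≯ a<b) = cong (a ∷_) (insert-++ʳ P X p)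

insert-++ˡ : ∀ {b} S T → All (b <_) T → insert b (S ++ T) ≡ insert b S ++ T
insert-++ˡ [] T p = insert-least T p
insert-++ˡ {b} (a ∷ S) T p with b <ᵇ a
... | true = refl
... | false = cong (a ∷_) (insert-++ˡ S T p)

insert-greatest : ∀ {b} S → All (_< b) S → insert b S ≡ S ++ b ∷ []
insert-greatest {b} S p = trans (cong (insert b) (sym (++-identityʳ S))) (insert-++ʳ S [] p)

insert-All : ∀ {P : ℕ → Set} {b} S → P b → All P S → All P (insert b S)
insert-All [] pb [] = pb ∷ []
insert-All {b = b} (a ∷ S) pb (pa ∷ p) with b <ᵇ a
... | true = pb ∷ pa ∷ p
... | false = pa ∷ insert-All S pb p

carrierStep-pick : ∀ {n b} S → movable n b ≡ true → All (_≤ b) S → carrierStep n S (just b) ≡ (nothing , insert b S)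
carrierStep-pick S mb p rewrite mb | popAbove-none S p = refl

carrierStep-exchange : ∀ {n b a S′} S → movable n b ≡ true → popAbove b S ≡ just (a , S′) →
  carrierStep n S (just b) ≡ (just a , insert b S′)
carrierStep-exchange S mb e rewrite mb | e = refl

movable-suc : ∀ m b → b ≢ suc m → movable m b ≡ movable (suc m) b
movable-suc m zero _ = refl
movable-suc m (suc j) b≢1+m with j <? m
... | yes j<m = trans (<ᵇ-true j<m) (sym (<ᵇ-true (m<n⇒m<1+n j<m)))
... | no j≮m = trans (<ᵇ-false j≮m) (sym (<ᵇ-false j≮1+m))
  where
    j≮1+m : ¬ j < suc m
    j≮1+m j<1+m = j≮m (≤∧≢⇒< (s≤s⁻¹ j<1+m) (λ j≡m → b≢1+m (cong suc j≡m)))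

movable⇒< : ∀ m b → movable m b ≡ true → b < suc m
movable⇒< m (suc j) e = s≤s (<ᵇ⇒< j m (subst T (sym e) tt))

movable-suc⇒< : ∀ m b → b ≢ suc m → movable (suc m) b ≡ true → b < suc m
movable-suc⇒< m b b≢1+m mov = movable⇒< m b (trans (movable-suc m b b≢1+m) mov)

carrierStep-suc : ∀ m S x → x ≢ just (suc m) → carrierStep m S x ≡ carrierStep (suc m) S x
carrierStep-suc m [] nothing _ = refl
carrierStep-suc m (a ∷ S) nothing _ = refl
carrierStep-suc m S (just b) x≢ rewrite movable-suc m b (λ b≡ → x≢ (cong just b≡)) = refl

sweep-zero : ∀ xs → sweep 0 [] xs ≡ xs
sweep-zero [] = refl
sweep-zero (nothing ∷ xs) = cong (nothing ∷_) (sweep-zero xs)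
sweep-zero (just zero ∷ xs) = cong (just zero ∷_) (sweep-zero xs)
sweep-zero (just (suc j) ∷ xs) = cong (just (suc j) ∷_) (sweep-zero xs)

sweep-suc : ∀ m S xs → All (suc m ≢_) (catMaybes xs) → sweep m S xs ≡ sweep (suc m) S xs
sweep-suc m S [] _ = refl
sweep-suc m S (nothing ∷ xs) p rewrite carrierStep-suc m S nothing (λ ()) = cong (_ ∷_) (sweep-suc m _ xs p)
sweep-suc m S (just b ∷ xs) (1+m≢b ∷ p) rewrite carrierStep-suc m S (just b) (λ e → 1+m≢b (sym (just-injective e))) =
  cong (_ ∷_) (sweep-suc m _ xs p)

place-map : ∀ k S → place k (map just S) ≡ map just (S ++ k ∷ [])
place-map k [] = refl
place-map k (a ∷ S) = cong (just a ∷_) (place-map k S)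

moveBall-map : ∀ k S → All (_< k) S → moveBall k (map just S) ≡ map just S
moveBall-map k [] [] = refl
moveBall-map k (a ∷ S) (a<k ∷ p) rewrite ≡ᵇ-false (<⇒≢ a<k) = cong (just a ∷_) (moveBall-map k S p)

place-sweep : ∀ m S xs → All (suc m ≢_) (catMaybes xs) → All (_< suc m) S →
  place (suc m) (sweep m S xs) ≡ sweep (suc m) (S ++ suc m ∷ []) xs
place-sweep m S [] _ _ = place-map (suc m) S
place-sweep m [] (nothing ∷ xs) p _ = cong (just (suc m) ∷_) (sweep-suc m [] xs p)
place-sweep m (a ∷ S) (nothing ∷ xs) p (_ ∷ q) = cong (just a ∷_) (place-sweep m S xs p q)
place-sweep m S (just b ∷ xs) (1+m≢b ∷ p) q
  rewrite movable-suc m b (≢-sym 1+m≢b) with movable (suc m) b in mov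
... | false = cong (just b ∷_) (place-sweep m S xs p q)
... | true with popAbove b S in pop | movable-suc⇒< m b (≢-sym 1+m≢b) mov
...   | nothing | b<1+m
      rewrite popAbove-++-nothing S (suc m ∷ []) pop | popAbove-first {b} [] [] [] b<1+m | ++-identityʳ S
      = cong (just (suc m) ∷_) (sweep-suc m (insert b S) xs p)
...   | just (a , S′) | b<1+m
      rewrite popAbove-++-just S (suc m ∷ []) pop | insert-++ˡ {b} S′ (suc m ∷ []) (b<1+m ∷ [])
      = cong (just a ∷_) (place-sweep m (insert b S′) xs p (insert-All S′ b<1+m (proj₂ (popAbove-All S q pop))))

moveBall-sweep : ∀ m S xs → Unique (catMaybes xs) → All (_< suc m) S →
  moveBall (suc m) (sweep m S xs) ≡ sweep (suc m) S xs
moveBall-sweep m S [] _ q = moveBall-map (suc m) S q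
moveBall-sweep m [] (nothing ∷ xs) u q = cong (nothing ∷_) (moveBall-sweep m [] xs u q)
moveBall-sweep m (a ∷ S) (nothing ∷ xs) u (a<1+m ∷ q)
  rewrite ≡ᵇ-false (<⇒≢ a<1+m) = cong (just a ∷_) (moveBall-sweep m S xs u q)
moveBall-sweep m S (just b ∷ xs) (b∉xs ∷ u) q with b ≟ suc m
... | yes refl
    rewrite <ᵇ-false (n≮n m) | <ᵇ-true (n<1+n m) | ≡ᵇ-refl m
          | popAbove-none S (All.map <⇒≤ q) | insert-greatest S q
    = cong (nothing ∷_) (place-sweep m S xs b∉xs q)
... | no b≢1+m rewrite movable-suc m b b≢1+m with movable (suc m) b in mov
...   | false rewrite ≡ᵇ-false b≢1+m = cong (just b ∷_) (moveBall-sweep m S xs u q)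
...   | true with popAbove b S in pop | movable-suc⇒< m b b≢1+m mov
...     | nothing | b<1+m = cong (nothing ∷_) (moveBall-sweep m (insert b S) xs u (insert-All S b<1+m q))
...     | just (a , S′) | b<1+m rewrite ≡ᵇ-false (<⇒≢ (proj₁ (popAbove-All S q pop))) =
          cong (just a ∷_) (moveBall-sweep m (insert b S′) xs u (insert-All S′ b<1+m (proj₂ (popAbove-All S q pop))))

oneTo-suc : ∀ n → oneTo (suc n) ≡ oneTo n ++ suc n ∷ []
oneTo-suc n = trans (cong (map suc) (sym (upTo-∷ʳ n))) (map-++ suc (upTo n) (n ∷ []))

moveBalls-sweep : ∀ c → Unique (catMaybes c) → ∀ m → foldl (λ d i → moveBall i d) c (oneTo m) ≡ sweep m [] c
moveBalls-sweep c u zero = sym (sweep-zero c)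
moveBalls-sweep c u (suc m) = begin
  foldl step c (oneTo (suc m))              ≡⟨ cong (foldl step c) (oneTo-suc m) ⟩
  foldl step c (oneTo m ++ suc m ∷ [])      ≡⟨ foldl-++ step c (oneTo m) (suc m ∷ []) ⟩
  moveBall (suc m) (foldl step c (oneTo m)) ≡⟨ cong (moveBall (suc m)) (moveBalls-sweep c u m) ⟩
  moveBall (suc m) (sweep m [] c)           ≡⟨ moveBall-sweep m [] c u [] ⟩
  sweep (suc m) [] c                        ∎
  where
    open ≡-Reasoning
    step = λ d i → moveBall i d

bbsMove-sweep : ∀ n c → Unique (catMaybes c) → bbsMove n c ≡ sweep n [] c
bbsMove-sweep n c u = moveBalls-sweep c u n

first<rest : ∀ {b} B → Linked _<_ (b ∷ B) → All (b <_) B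
first<rest [] _ = []
first<rest (c ∷ B) l = Linked⇒All <-trans (Linked.head l) (Linked.tail l)

carry-row : ∀ n B P C → Linked _<_ B → Linked _<_ C → ColStrict B C → All (λ p → All (p <_) B) P → Movable n B →
  carry n (P ++ C) (map just B) ≡ (map just C ++ blank (length B ∸ length C) , P ++ B)
carry-row n [] P [] _ _ _ _ _ = refl
carry-row n (b ∷ B) P [] lB _ _ pP (mb ∷ mB)
  rewrite ++-identityʳ P | mb | popAbove-none P (All.map (<⇒≤ ∘ All.head) pP) | insert-greatest P (All.map All.head pP)
  with carry-row n B (P ++ b ∷ []) [] (Linked.tail lB) [] tt (All.++⁺ (All.map All.tail pP) (first<rest B lB ∷ [])) mB
... | ih rewrite ++-identityʳ (P ++ b ∷ []) | ih | ++-assoc P (b ∷ []) B = refl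
carry-row n (b ∷ B) P (c ∷ C) lB lC (b<c , bC) pP (mb ∷ mB)
  rewrite mb | popAbove-first P C (All.map (<⇒≤ ∘ All.head) pP) b<c
        | insert-++ʳ P C (All.map All.head pP) | insert-least C (All.map (<-trans b<c) (first<rest C lC))
        | sym (++-assoc P (b ∷ []) C)
        | carry-row n B (P ++ b ∷ []) C (Linked.tail lB) (Linked.tail lC) bC (All.++⁺ (All.map All.tail pP) (first<rest B lB ∷ [])) mB
        | ++-assoc P (b ∷ []) B = refl

carry-blank-[] : ∀ n g → carry n [] (blank g) ≡ (blank g , [])
carry-blank-[] n zero = refl
carry-blank-[] n (suc g) rewrite carry-blank-[] n g = refl

carry-blank : ∀ n B g → carry n B (blank g) ≡ (map just (take g B) ++ blank (g ∸ length B) , drop g B)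
carry-blank n [] zero = refl
carry-blank n (b ∷ B) zero = refl
carry-blank n [] (suc g) rewrite carry-blank-[] n g = refl
carry-blank n (b ∷ B) (suc g) rewrite carry-blank n B g = refl

blank-++ : ∀ a b (X : Config) → blank a ++ blank b ++ X ≡ blank (a + b) ++ X
blank-++ zero b X = refl
blank-++ (suc a) b X = cong (nothing ∷_) (blank-++ a b X)

take-blank-drop : ∀ g B (X : Config) →
  map just (take g B) ++ blank (g ∸ length B) ++ map just (drop g B) ++ X ≡ map just B ++ blank (g ∸ length B) ++ X
take-blank-drop zero [] X = refl
take-blank-drop zero (b ∷ B) X = refl
take-blank-drop (suc g) [] X = refl
take-blank-drop (suc g) (b ∷ B) X = cong (just b ∷_) (take-blank-drop g B X)

sweep-row : ∀ n C B g X → Linked _<_ B → Linked _<_ C → ColStrict B C → Movable n B →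
  sweep n C (map just B ++ blank g ++ X) ≡
    map just C ++ blank (length B ∸ length C) ++ map just (take g B) ++ blank (g ∸ length B) ++ sweep n (drop g B) X
sweep-row n C B g X lB lC bC mB
  rewrite sweep-++ n C (map just B) (blank g ++ X) | carry-row n B [] C lB lC bC [] mB
        | sweep-++ n B (blank g) X | carry-blank n B g =
  trans (++-assoc (map just C) (blank (length B ∸ length C)) _)
        (cong (λ Y → map just C ++ blank (length B ∸ length C) ++ Y) (++-assoc (map just (take g B)) (blank (g ∸ length B)) _))

-- Trains of solitons

Row : List ℕ → Set
Row B = 0 < length B × Linked _<_ B

Block : Set
Block = List ℕ × ℕ

layout : List Block → Config
layout [] = []
layout ((B , g) ∷ rest) = map just B ++ blank g ++ layout rest

rows : List Block → List (List ℕ)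
rows = map proj₁

-- Having passed B and the following g empty boxes, the carrier still holds drop g B;
-- the next block B′ must sit column-strictly above it.
Precedes : Block → Block → Set
Precedes (B , g) (B′ , _) = ColStrict B′ (drop g B) × length B ≤ length B′

SteadyChain : List Block → Set
SteadyChain ch = All (Row ∘ proj₁) ch × Linked Precedes ch

headLength : List Block → ℕ
headLength [] = 0
headLength ((B′ , _) ∷ _) = length B′

-- Under a BBS move every block travels to the right by its own length.
advance : List Block → List Block
advance [] = []
advance ((B , g) ∷ rest) = (B , g + headLength rest ∸ length B) ∷ advance rest

rows-advance : ∀ ch → rows (advance ch) ≡ rows ch
rows-advance [] = refl
rows-advance ((B , g) ∷ rest) = cong (B ∷_) (rows-advance rest)

gap-advance : ∀ g b b′ → (g ∸ b) + (b′ ∸ (b ∸ g)) ≡ g + b′ ∸ b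
gap-advance g b b′ with ≤-total b g
... | inj₁ b≤g rewrite m≤n⇒m∸n≡0 b≤g = sym (+-∸-comm b′ b≤g)
... | inj₂ g≤b rewrite m≤n⇒m∸n≡0 g≤b = begin
  b′ ∸ (b ∸ g)             ≡⟨ [m+n]∸[m+o]≡n∸o g b′ (b ∸ g) ⟨
  g + b′ ∸ (g + (b ∸ g))   ≡⟨ cong (g + b′ ∸_) (m+[n∸m]≡n g≤b) ⟩
  g + b′ ∸ b               ∎
  where open ≡-Reasoning

linked-drop : ∀ g B → Linked _<_ B → Linked _<_ (drop g B)
linked-drop zero B l = l
linked-drop (suc g) [] l = l
linked-drop (suc g) (b ∷ B) l = linked-drop g B (Linked.tail l)

colStrict-tail : ∀ U {x} X → Linked _<_ (x ∷ X) → ColStrict U (x ∷ X) → ColStrict U X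
colStrict-tail U [] _ _ = tt
colStrict-tail [] (x′ ∷ X) _ ()
colStrict-tail (u ∷ U) (x′ ∷ X) (x<x′ ∷ l) (u<x , c) = <-trans u<x x<x′ , colStrict-tail U X l c

colStrict-drop-mono : ∀ {U g g′} X → g ≤ g′ → Linked _<_ X → ColStrict U (drop g X) → ColStrict U (drop g′ X)
colStrict-drop-mono {g′ = zero} X z≤n _ c = c
colStrict-drop-mono {g′ = suc g′} [] z≤n _ _ = tt
colStrict-drop-mono {U} {g′ = suc g′} (x ∷ X) z≤n l c =
  colStrict-drop-mono {g′ = g′} X z≤n (Linked.tail l) (colStrict-tail U X l c)
colStrict-drop-mono [] (s≤s _) _ _ = tt
colStrict-drop-mono (x ∷ X) (s≤s g≤g′) l c = colStrict-drop-mono X g≤g′ (Linked.tail l) c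

gap-grows : ∀ g {b b′} → b ≤ b′ → g ≤ g + b′ ∸ b
gap-grows g {b} b≤b′ = subst (_≤ g + _ ∸ b) (m+n∸n≡m g b) (∸-monoˡ-≤ b (+-monoʳ-≤ g b≤b′))

advance-steady : ∀ ch → SteadyChain ch → SteadyChain (advance ch)
advance-steady [] _ = [] , []
advance-steady ((B , g) ∷ []) (r ∷ [] , [-]) = r ∷ [] , [-]
advance-steady ((B , g) ∷ (B′ , g′) ∷ rest) (r ∷ rs , (B′≺B , len) ∷ ps) with advance-steady ((B′ , g′) ∷ rest) (rs , ps)
... | rs′ , ps′ = r ∷ rs′ , (colStrict-drop-mono B (gap-grows g len) (proj₂ r) B′≺B , len) ∷ ps′

sweep-layout : ∀ n C B g rest → SteadyChain ((B , g) ∷ rest) → Linked _<_ C → ColStrict B C →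
  Movable n (concat (rows ((B , g) ∷ rest))) →
  sweep n C (layout ((B , g) ∷ rest)) ≡ map just C ++ blank (length B ∸ length C) ++ layout (advance ((B , g) ∷ rest))
sweep-layout n C B g [] (r ∷ [] , _) lC bC mv rewrite +-identityʳ g = begin
  sweep n C (map just B ++ blank g ++ [])
    ≡⟨ sweep-row n C B g [] (proj₂ r) lC bC (All.++⁻ˡ B mv) ⟩
  map just C ++ k ++ map just (take g B) ++ blank (g ∸ length B) ++ map just (drop g B)
    ≡⟨ cong (λ Y → map just C ++ k ++ map just (take g B) ++ blank (g ∸ length B) ++ Y) (++-identityʳ _) ⟨
  map just C ++ k ++ map just (take g B) ++ blank (g ∸ length B) ++ map just (drop g B) ++ []
    ≡⟨ cong (λ Y → map just C ++ k ++ Y) (take-blank-drop g B []) ⟩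
  map just C ++ k ++ map just B ++ blank (g ∸ length B) ++ [] ∎
  where
    open ≡-Reasoning
    k = blank (length B ∸ length C)
sweep-layout n C B g ((B′ , g′) ∷ rest) (r ∷ rs , (B′≺B , _) ∷ ps) lC bC mv = begin
  sweep n C (layout ((B , g) ∷ R))
    ≡⟨ sweep-row n C B g (layout R) (proj₂ r) lC bC (All.++⁻ˡ B mv) ⟩
  map just C ++ k ++ map just (take g B) ++ blank (g ∸ length B) ++ sweep n (drop g B) (layout R)
    ≡⟨ cong (λ Y → map just C ++ k ++ map just (take g B) ++ blank (g ∸ length B) ++ Y)
            (sweep-layout n (drop g B) B′ g′ rest (rs , ps) (linked-drop g B (proj₂ r)) B′≺B (All.++⁻ʳ B mv)) ⟩
  map just C ++ k ++ map just (take g B) ++ blank (g ∸ length B) ++ map just (drop g B) ++ blank (length B′ ∸ length (drop g B)) ++ layout (advance R)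
    ≡⟨ cong (λ Y → map just C ++ k ++ Y) (take-blank-drop g B _) ⟩
  map just C ++ k ++ map just B ++ blank (g ∸ length B) ++ blank (length B′ ∸ length (drop g B)) ++ layout (advance R)
    ≡⟨ cong (λ Y → map just C ++ k ++ map just B ++ Y) (blank-++ (g ∸ length B) _ _) ⟩
  map just C ++ k ++ map just B ++ blank ((g ∸ length B) + (length B′ ∸ length (drop g B))) ++ layout (advance R)
    ≡⟨ cong (λ d → map just C ++ k ++ map just B ++ blank d ++ layout (advance R)) gap ⟩
  map just C ++ k ++ map just B ++ blank (g + length B′ ∸ length B) ++ layout (advance R) ∎
  where
    open ≡-Reasoning
    R = (B′ , g′) ∷ rest
    k = blank (length B ∸ length C)
    gap : (g ∸ length B) + (length B′ ∸ length (drop g B)) ≡ g + length B′ ∸ length B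
    gap rewrite length-drop g B = gap-advance g (length B) (length B′)

runsAux-row : ∀ b B ys {c rs} → Linked _<_ (b ∷ B) → runsAux ys ≡ (c , rs) → MaybeAll.All (_< b) (head c) →
  runsAux (map just (b ∷ B) ++ ys) ≡ (b ∷ B , consNE c rs)
runsAux-row b [] ys {[]} _ eq _ rewrite eq = refl
runsAux-row b [] ys {h ∷ c} _ eq (MaybeAll.just h<b) rewrite eq | <ᵇ-false (<⇒≯ h<b) = refl
runsAux-row b (b′ ∷ B) ys (b<b′ ∷ l) eq first
  rewrite runsAux-row b′ B ys l eq (MaybeAll.map (λ h<b → <-trans h<b b<b′) first) | <ᵇ-true b<b′ = refl

mutual
  runsAux-layout : ∀ B g rest → SteadyChain ((B , g) ∷ rest) → runsAux (layout ((B , g) ∷ rest)) ≡ (B , rows rest)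
  runsAux-layout [] g rest ((() , _) ∷ _ , _)
  runsAux-layout (b ∷ B) (suc g) rest (r ∷ rs , ps) =
    trans (runsAux-row b B (nothing ∷ blank g ++ layout rest) (proj₂ r) refl MaybeAll.nothing)
          (cong (b ∷ B ,_) (increasingRuns-layout g rest (rs , Linked.tail ps)))
  runsAux-layout (b ∷ B) zero [] (r ∷ [] , _) = runsAux-row b B [] (proj₂ r) refl MaybeAll.nothing
  runsAux-layout (b ∷ B) zero (([] , g′) ∷ rest) (_ ∷ (() , _) ∷ _ , _)
  runsAux-layout (b ∷ B) zero ((b′ ∷ B′ , g′) ∷ rest) (r ∷ rs , ((b′<b , _) , _) ∷ ps) =
    runsAux-row b B _ (proj₂ r) (runsAux-layout (b′ ∷ B′) g′ rest (rs , ps)) (MaybeAll.just b′<b)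

  increasingRuns-layout : ∀ a ch → SteadyChain ch → increasingRuns (blank a ++ layout ch) ≡ rows ch
  increasingRuns-layout (suc a) ch s = increasingRuns-layout a ch s
  increasingRuns-layout zero [] _ = refl
  increasingRuns-layout zero (([] , g) ∷ rest) ((() , _) ∷ _ , _)
  increasingRuns-layout zero ((b ∷ B , g) ∷ rest) s rewrite runsAux-layout (b ∷ B) g rest s = refl

catMaybes-blank : ∀ a → catMaybes (blank a) ≡ []
catMaybes-blank zero = refl
catMaybes-blank (suc a) = catMaybes-blank a

catMaybes-layout : ∀ ch → catMaybes (layout ch) ≡ concat (rows ch)
catMaybes-layout [] = refl
catMaybes-layout ((B , g) ∷ rest)
  rewrite catMaybes-++ (map just B) (blank g ++ layout rest) | catMaybes-++ (blank g) (layout rest)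
        | mapMaybe-just B | catMaybes-blank g | catMaybes-layout rest = refl

sweep-blank : ∀ n a X → sweep n [] (blank a ++ X) ≡ blank a ++ sweep n [] X
sweep-blank n a X rewrite sweep-++ n [] (blank a) X | carry-blank-[] n a = refl

record Solitons (n : ℕ) (ch : List Block) : Set where
  field
    steady   : SteadyChain ch
    movableBalls  : Movable n (concat (rows ch))
    distinctBalls : Unique (concat (rows ch))

bbsMove-layout : ∀ n a ch → Solitons n ch → ∃[ a′ ] bbsMove n (blank a ++ layout ch) ≡ blank a′ ++ layout (advance ch)
bbsMove-layout n a ch s = a′ ch , (begin
  bbsMove n (blank a ++ layout ch)  ≡⟨ bbsMove-sweep n _ distinct′ ⟩
  sweep n [] (blank a ++ layout ch) ≡⟨ sweep-blank n a (layout ch) ⟩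
  blank a ++ sweep n [] (layout ch) ≡⟨ shifted ch steady movableBalls ⟩
  blank (a′ ch) ++ layout (advance ch) ∎)
  where
    open ≡-Reasoning
    open Solitons s
    distinct′ : Unique (catMaybes (blank a ++ layout ch))
    distinct′ rewrite catMaybes-++ (blank a) (layout ch) | catMaybes-blank a | catMaybes-layout ch = distinctBalls
    a′ : List Block → ℕ
    a′ [] = a
    a′ ((B , _) ∷ _) = a + length B
    shifted : ∀ ch → SteadyChain ch → Movable n (concat (rows ch)) →
      blank a ++ sweep n [] (layout ch) ≡ blank (a′ ch) ++ layout (advance ch)
    shifted [] _ _ = refl
    shifted ((B , g) ∷ rest) st mv = trans (cong (blank a ++_) (sweep-layout n [] B g rest st [] tt mv)) (blank-++ a (length B) _)

solitons-advance : ∀ {n} ch → Solitons n ch → Solitons n (advance ch)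
solitons-advance {n} ch s = record
  { steady        = advance-steady ch steady
  ; movableBalls  = subst (Movable n ∘ concat) (sym (rows-advance ch)) movableBalls
  ; distinctBalls = subst (Unique ∘ concat) (sym (rows-advance ch)) distinctBalls
  }
  where open Solitons s

increasingRuns-bbsIter : ∀ n k a ch → Solitons n ch → increasingRuns (bbsIter n k (blank a ++ layout ch)) ≡ rows ch
increasingRuns-bbsIter n zero a ch s = increasingRuns-layout a ch (Solitons.steady s)
increasingRuns-bbsIter n (suc k) a ch s with bbsMove-layout n a ch s
... | a′ , eq rewrite eq = trans (increasingRuns-bbsIter n k a′ (advance ch) (solitons-advance ch s)) (rows-advance ch)

steadyState-layout : ∀ n a ch → Solitons n ch → SteadyState n (blank a ++ layout ch)
steadyState-layout n a ch s k = trans (increasingRuns-bbsIter n k a ch s) (sym (increasingRuns-bbsIter n 0 a ch s))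

consNE-concat : ∀ (c : List ℕ) rs → concat (consNE c rs) ≡ c ++ concat rs
consNE-concat [] rs = refl
consNE-concat (a ∷ c) rs = refl

runsAux-concat : ∀ c → proj₁ (runsAux c) ++ concat (proj₂ (runsAux c)) ≡ catMaybes c
runsAux-concat [] = refl
runsAux-concat (nothing ∷ xs) = trans (consNE-concat (proj₁ (runsAux xs)) _) (runsAux-concat xs)
runsAux-concat (just x ∷ xs) with runsAux xs | runsAux-concat xs
... | [] , rs | ih = cong (x ∷_) ih
... | (b ∷ bs) , rs | ih with x <ᵇ b
...   | true = cong (x ∷_) ih
...   | false = cong (x ∷_) ih

concat-increasingRuns : ∀ c → concat (increasingRuns c) ≡ catMaybes c
concat-increasingRuns c = trans (consNE-concat (proj₁ (runsAux c)) _) (runsAux-concat c)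

steadyStateTime-one : ∀ w a ch → Solitons (length w) ch → stateAt w 1 ≡ blank a ++ layout ch → w ≢ concat (rows ch) →
  SteadyStateTime w 1
steadyStateTime-one w a ch s state₁ w≢rows =
  subst (SteadyState (length w)) (sym state₁) (steadyState-layout (length w) a ch s) , not-steady₀
  where
    not-steady₀ : ∀ t → t < 1 → ¬ SteadyState (length w) (stateAt w t)
    not-steady₀ zero _ steady₀ = w≢rows (begin
      w                                     ≡⟨ mapMaybe-just w ⟨
      catMaybes (map just w)                ≡⟨ concat-increasingRuns (map just w) ⟨
      concat (increasingRuns (map just w))  ≡⟨ cong concat (steady₀ 1) ⟨
      concat (increasingRuns (stateAt w 1)) ≡⟨ cong (concat ∘ increasingRuns) state₁ ⟩
      concat (increasingRuns (blank a ++ layout ch))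
        ≡⟨ cong concat (increasingRuns-layout a ch (Solitons.steady s)) ⟩
      concat (rows ch)                      ∎)
      where open ≡-Reasoning
    not-steady₀ (suc t) (s≤s ())

-- The perturbed reading word at time one

Stacked : List (List ℕ) → Set
Stacked = Linked (λ B B′ → ColStrict B′ B)

colStrict-length : ∀ U L → ColStrict U L → length L ≤ length U
colStrict-length U [] _ = z≤n
colStrict-length (u ∷ U) (x ∷ L) (_ , c) = s≤s (colStrict-length U L c)

gapless : List (List ℕ) → List Block
gapless = map (_, 0)

rows-gapless : ∀ Bs → rows (gapless Bs) ≡ Bs
rows-gapless [] = refl
rows-gapless (B ∷ Bs) = cong (B ∷_) (rows-gapless Bs)

layout-gapless : ∀ Bs → layout (gapless Bs) ≡ map just (concat Bs)
layout-gapless [] = refl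
layout-gapless (B ∷ Bs) rewrite layout-gapless Bs = sym (map-++ just B (concat Bs))

steady-gapless : ∀ Bs → All Row Bs → Stacked Bs → SteadyChain (gapless Bs)
steady-gapless Bs rs st = All.map⁺ rs , Linked-map⁺ (Linked.map (λ {B} {B′} c → c , colStrict-length B′ B c) st)

lastOr : List ℕ → List (List ℕ) → List ℕ
lastOr C [] = C
lastOr C (B ∷ Bs) = lastOr B Bs

carry-gapless : ∀ n C Bs → All Row Bs → Stacked (C ∷ Bs) → Linked _<_ C → Movable n (concat Bs) →
  proj₂ (carry n C (layout (gapless Bs))) ≡ lastOr C Bs
carry-gapless n C [] _ _ _ _ = refl
carry-gapless n C (B ∷ Bs) (r ∷ rs) (B≺C ∷ st) lC mv
  rewrite carry-++ n C (map just B) (layout (gapless Bs)) | carry-row n B [] C (proj₂ r) lC B≺C [] (All.++⁻ˡ B mv)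
  = carry-gapless n B Bs rs st (proj₂ r) (All.++⁻ʳ B mv)

finalGap : List ℕ → List (List ℕ) → ℕ → ℕ
finalGap B [] k = k
finalGap B (B′ ∷ _) k = length B′ ∸ length B

settle : List (List ℕ) → ℕ → List Block
settle [] k = []
settle (B ∷ Bs) k = (B , finalGap B Bs k) ∷ settle Bs k

rows-settle : ∀ Bs k → rows (settle Bs k) ≡ Bs
rows-settle [] k = refl
rows-settle (B ∷ Bs) k = cong (B ∷_) (rows-settle Bs k)

advance-gapless : ∀ Bs → advance (gapless Bs) ≡ settle Bs 0
advance-gapless [] = refl
advance-gapless (B ∷ []) = cong (λ g → (B , g) ∷ []) (0∸n≡0 (length B))
advance-gapless (B ∷ B′ ∷ Bs) = cong ((B , length B′ ∸ length B) ∷_) (advance-gapless (B′ ∷ Bs))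

blank-∷ʳ : ∀ k (Y : Config) → blank k ++ nothing ∷ Y ≡ nothing ∷ blank k ++ Y
blank-∷ʳ zero Y = refl
blank-∷ʳ (suc k) Y = cong (nothing ∷_) (blank-∷ʳ k Y)

++-assoc₃ : ∀ (a b c d : Config) → (a ++ b ++ c) ++ d ≡ a ++ b ++ c ++ d
++-assoc₃ a b c d = trans (++-assoc a (b ++ c) d) (cong (a ++_) (++-assoc b c d))

layout-settle-∷ʳ : ∀ B Bs k Y → layout (settle (B ∷ Bs) k) ++ nothing ∷ Y ≡ layout (settle (B ∷ Bs) (suc k)) ++ Y
layout-settle-∷ʳ B [] k Y =
  trans (++-assoc₃ (map just B) (blank k) [] (nothing ∷ Y))
        (trans (cong (map just B ++_) (blank-∷ʳ k Y)) (sym (++-assoc₃ (map just B) (blank (suc k)) [] Y)))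
layout-settle-∷ʳ B (B′ ∷ Bs) k Y =
  trans (++-assoc₃ (map just B) g (layout (settle (B′ ∷ Bs) k)) (nothing ∷ Y))
        (trans (cong (λ Z → map just B ++ g ++ Z) (layout-settle-∷ʳ B′ Bs k Y))
               (sym (++-assoc₃ (map just B) g (layout (settle (B′ ∷ Bs) (suc k))) Y)))
  where g = blank (length B′ ∸ length B)

sweep-gapless : ∀ n C B Bs → All Row (B ∷ Bs) → Stacked (C ∷ B ∷ Bs) → Linked _<_ C → Movable n (concat (B ∷ Bs)) →
  sweep n C (layout (gapless (B ∷ Bs))) ≡ map just C ++ blank (length B ∸ length C) ++ layout (settle (B ∷ Bs) 0)
sweep-gapless n C B Bs rs (B≺C ∷ st) lC mv =
  trans (sweep-layout n C B 0 (gapless Bs) (steady-gapless (B ∷ Bs) rs st) lC B≺C mv′)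
        (cong (λ ch → map just C ++ blank (length B ∸ length C) ++ layout ch) (advance-gapless (B ∷ Bs)))
  where mv′ = subst (Movable n ∘ concat) (sym (rows-gapless (B ∷ Bs))) mv

under-singleton : ∀ {l} C → ColStrict (l ∷ []) C → length C ≤ 1 × All (l <_) C
under-singleton [] _ = z≤n , []
under-singleton (p ∷ []) (l<p , _) = s≤s z≤n , l<p ∷ []

carrierStep-under : ∀ {n b} C → movable n b ≡ true → length C ≤ 1 → All (b <_) C → carrierStep n C (just b) ≡ (head C , b ∷ [])
carrierStep-under [] mb _ _ = carrierStep-pick [] mb []
carrierStep-under (p ∷ []) mb _ (b<p ∷ []) = carrierStep-exchange (p ∷ []) mb (popAbove-first [] [] [] b<p)
carrierStep-under (p ∷ q ∷ C) _ (s≤s ()) _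

-- C is the row below the singleton row (l), held by the carrier when it reaches the window W.
WindowRule : ℕ → ℕ → ℕ → ℕ → List ℕ → Set
WindowRule n l u₁ u₂ W =
  ∀ C → ColStrict (l ∷ []) C → carry n C (map just W) ≡ (head C ∷ nothing ∷ just l ∷ [] , u₁ ∷ u₂ ∷ [])

k1-window : ∀ {n l u₁ u₂} → u₁ < l → l < u₂ → Movable n (l ∷ u₂ ∷ u₁ ∷ []) →
  WindowRule n l u₁ u₂ (l ∷ u₂ ∷ u₁ ∷ [])
k1-window {l = l} {u₁} {u₂} u₁<l l<u₂ (ml ∷ m₂ ∷ m₁ ∷ []) C l≺C with under-singleton C l≺C
... | |C|≤1 , l<C
  rewrite carrierStep-under C ml |C|≤1 l<C
        | carrierStep-pick (l ∷ []) m₂ (<⇒≤ l<u₂ ∷ []) | insert-greatest (l ∷ []) (l<u₂ ∷ [])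
        | carrierStep-exchange (l ∷ u₂ ∷ []) m₁ (popAbove-first [] (u₂ ∷ []) [] u₁<l)
        | insert-least (u₂ ∷ []) (<-trans u₁<l l<u₂ ∷ []) = refl

k2-window : ∀ {n l u₁ u₂} → u₁ < u₂ → u₂ < l → Movable n (u₁ ∷ l ∷ u₂ ∷ []) →
  WindowRule n l u₁ u₂ (u₁ ∷ l ∷ u₂ ∷ [])
k2-window {l = l} {u₁} {u₂} u₁<u₂ u₂<l (m₁ ∷ ml ∷ m₂ ∷ []) C l≺C with under-singleton C l≺C | <-trans u₁<u₂ u₂<l
... | |C|≤1 , l<C | u₁<l
  rewrite carrierStep-under C m₁ |C|≤1 (All.map (<-trans u₁<l) l<C)
        | carrierStep-pick (u₁ ∷ []) ml (<⇒≤ u₁<l ∷ []) | insert-greatest (u₁ ∷ []) (u₁<l ∷ [])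
        | carrierStep-exchange (u₁ ∷ l ∷ []) m₂ (popAbove-first (u₁ ∷ []) [] (<⇒≤ u₁<u₂ ∷ []) u₂<l)
        | insert-greatest (u₁ ∷ []) (u₁<u₂ ∷ []) = refl

record Junction (Bs0 : List (List ℕ)) (L U : List ℕ) (Bs3 : List (List ℕ)) : Set where
  field
    rows₀    : All Row Bs0
    stacked₀ : Stacked Bs0
    L≺last₀  : ColStrict L (lastOr [] Bs0)
    rowL     : Row L
    rowU     : Row U
    U≺L      : ColStrict U L
    rows₃    : All Row Bs3
    stacked₃ : Stacked (U ∷ Bs3)

stacked-split : ∀ Bs0 L Us → Stacked (Bs0 ++ L ∷ Us) → Stacked Bs0 × ColStrict L (lastOr [] Bs0) × Stacked (L ∷ Us)
stacked-split [] L Us st = [] , tt , st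
stacked-split (B ∷ []) L Us (L≺B ∷ st) = [-] , L≺B , st
stacked-split (B ∷ B′ ∷ Bs) L Us (B′≺B ∷ st) with stacked-split (B′ ∷ Bs) L Us st
... | st₀ , j , st₁ = B′≺B ∷ st₀ , j , st₁

junction : ∀ Bs0 L U Bs3 → All Row (Bs0 ++ L ∷ U ∷ Bs3) → Stacked (Bs0 ++ L ∷ U ∷ Bs3) → Junction Bs0 L U Bs3
junction Bs0 L U Bs3 rs st with All.++⁻ Bs0 rs | stacked-split Bs0 L (U ∷ Bs3) st
... | rs₀ , rL ∷ rU ∷ rs₃ | st₀ , j , U≺L ∷ st₃ = record
  { rows₀ = rs₀ ; stacked₀ = st₀ ; L≺last₀ = j ; rowL = rL ; rowU = rU ; U≺L = U≺L ; rows₃ = rs₃ ; stacked₃ = st₃ }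

stacked-under-[] : ∀ Bs → Stacked Bs → Stacked ([] ∷ Bs)
stacked-under-[] [] _ = [-]
stacked-under-[] (B ∷ Bs) st = tt ∷ st

lastOr-All : ∀ {P : List ℕ → Set} C Bs → P C → All P Bs → P (lastOr C Bs)
lastOr-All C [] pC _ = pC
lastOr-All C (B ∷ Bs) _ (pB ∷ ps) = lastOr-All B Bs pB ps

row-under-singleton : ∀ {l} C → Row C → ColStrict (l ∷ []) C → ∃[ p ] C ≡ p ∷ []
row-under-singleton (p ∷ []) _ _ = p , refl

layout-++ : ∀ xs ys → layout (xs ++ ys) ≡ layout xs ++ layout ys
layout-++ [] ys = refl
layout-++ ((B , g) ∷ xs) ys rewrite layout-++ xs ys = sym (++-assoc₃ (map just B) (blank g) (layout xs) (layout ys))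

-- The state at time one: as for the reading word itself, except that the singleton row (l)
-- sits one box further to the right.
perturbedChain : List (List ℕ) → ℕ → List ℕ → List (List ℕ) → List Block
perturbedChain Bs0 l U Bs3 = settle Bs0 1 ++ (l ∷ [] , length U ∸ 2) ∷ settle (U ∷ Bs3) 0

rows-perturbedChain : ∀ Bs0 l U Bs3 → rows (perturbedChain Bs0 l U Bs3) ≡ Bs0 ++ (l ∷ []) ∷ U ∷ Bs3
rows-perturbedChain Bs0 l U Bs3 rewrite map-++ proj₁ (settle Bs0 1) ((l ∷ [] , length U ∸ 2) ∷ settle (U ∷ Bs3) 0)
  | rows-settle Bs0 1 | rows-settle (U ∷ Bs3) 0 = refl

steady-settle-++ : ∀ Bs k rest → All Row Bs → Stacked Bs → SteadyChain rest → Linked Precedes ((lastOr [] Bs , k) ∷ rest) →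
  SteadyChain (settle Bs k ++ rest)
steady-settle-++ [] k rest _ _ s _ = s
steady-settle-++ (B ∷ []) k rest (r ∷ []) _ (rs , _) j = r ∷ rs , j
steady-settle-++ (B ∷ B′ ∷ Bs) k rest (r ∷ rs) (B′≺B ∷ st) s j with steady-settle-++ (B′ ∷ Bs) k rest rs st s j
... | rs′ , ps′ =
  r ∷ rs′ , (colStrict-drop-mono {g′ = length B′ ∸ length B} B z≤n (proj₂ r) B′≺B , colStrict-length B′ B B′≺B) ∷ ps′

steady-perturbedChain : ∀ {Bs0 l u₁ u₂ U′ Bs3} → Junction Bs0 (l ∷ []) (u₁ ∷ u₂ ∷ U′) Bs3 →
  SteadyChain (perturbedChain Bs0 l (u₁ ∷ u₂ ∷ U′) Bs3)
steady-perturbedChain {Bs0} {l} {u₁} {u₂} {U′} {Bs3} j =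
  steady-settle-++ Bs0 1 rest rows₀ stacked₀ (rowL ∷ rs , l≺U) (last₀≺l (lastOr [] Bs0) L≺last₀ ∷ l≺U)
  where
    open Junction j
    U = u₁ ∷ u₂ ∷ U′
    rest = (l ∷ [] , length U′) ∷ settle (U ∷ Bs3) 0
    steadyU : SteadyChain (settle (U ∷ Bs3) 0)
    steadyU = subst SteadyChain (++-identityʳ _) (steady-settle-++ (U ∷ Bs3) 0 [] (rowU ∷ rows₃) stacked₃ ([] , []) [-])
    rs = proj₁ steadyU
    U≺l : ∀ V → ColStrict U (drop (length V) (l ∷ []))
    U≺l [] = U≺L
    U≺l (_ ∷ V) = subst (ColStrict U) (sym (drop-[] (length V))) tt
    last₀≺l : ∀ C → ColStrict (l ∷ []) C → Precedes (C , 1) (l ∷ [] , length U′)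
    last₀≺l [] _ = tt , z≤n
    last₀≺l (p ∷ []) _ = tt , s≤s z≤n
    l≺U : Linked Precedes rest
    l≺U = (U≺l U′ , s≤s z≤n) ∷ proj₂ steadyU

sweep-settle : ∀ n U Bs → Row U → All Row Bs → Stacked (U ∷ Bs) → Movable n (concat Bs) →
  sweep n U (layout (gapless Bs)) ≡ layout (settle (U ∷ Bs) 0)
sweep-settle n U [] _ _ _ _ = sym (++-identityʳ (map just U))
sweep-settle n U (B ∷ Bs) rU rs st mv = sweep-gapless n U B Bs rs st (proj₂ rU) mv

sweep-tail : ∀ n u₁ u₂ U′ Bs3 → Row (u₁ ∷ u₂ ∷ U′) → All Row Bs3 → Stacked ((u₁ ∷ u₂ ∷ U′) ∷ Bs3) →
  Movable n (U′ ++ concat Bs3) →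
  sweep n (u₁ ∷ u₂ ∷ []) (map just U′ ++ layout (gapless Bs3))
    ≡ blank (length U′) ++ layout (settle ((u₁ ∷ u₂ ∷ U′) ∷ Bs3) 0)
sweep-tail n u₁ u₂ U′ Bs3 rU rs₃ st mv = begin
  sweep n (u₁ ∷ u₂ ∷ []) (map just U′ ++ layout (gapless Bs3))
    ≡⟨ sweep-++ n (u₁ ∷ u₂ ∷ []) (map just U′) (layout (gapless Bs3)) ⟩
  proj₁ (carry n (u₁ ∷ u₂ ∷ []) (map just U′)) ++ sweep n (proj₂ (carry n (u₁ ∷ u₂ ∷ []) (map just U′))) (layout (gapless Bs3))
    ≡⟨ cong (λ r → proj₁ r ++ sweep n (proj₂ r) (layout (gapless Bs3)))
            (carry-row n U′ (u₁ ∷ u₂ ∷ []) [] lU′ [] tt u₁u₂<U′ (All.++⁻ˡ U′ mv)) ⟩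
  blank (length U′) ++ sweep n (u₁ ∷ u₂ ∷ U′) (layout (gapless Bs3))
    ≡⟨ cong (blank (length U′) ++_) (sweep-settle n (u₁ ∷ u₂ ∷ U′) Bs3 rU rs₃ st (All.++⁻ʳ U′ mv)) ⟩
  blank (length U′) ++ layout (settle ((u₁ ∷ u₂ ∷ U′) ∷ Bs3) 0) ∎
  where
    open ≡-Reasoning
    lU = proj₂ rU
    lU′ = Linked.tail (Linked.tail lU)
    u₁u₂<U′ = All.tail (first<rest (u₂ ∷ U′) lU) ∷ first<rest U′ (Linked.tail lU) ∷ []

sweep-prefix : ∀ n l Bs0 → All Row Bs0 → Stacked Bs0 → Movable n (concat Bs0) → ColStrict (l ∷ []) (lastOr [] Bs0) → ∀ Z →
  ∃[ a ] proj₁ (carry n [] (layout (gapless Bs0))) ++ head (lastOr [] Bs0) ∷ nothing ∷ Z ≡ blank a ++ layout (settle Bs0 1) ++ Z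
sweep-prefix n l [] _ _ _ _ Z = 2 , refl
sweep-prefix n l (B ∷ Bs) rs st mv l≺C₀ Z with row-under-singleton (lastOr B Bs) (lastOr-All B Bs (All.head rs) (All.tail rs)) l≺C₀
... | p , C₀≡p = length B , (begin
  O ++ head C₀ ∷ nothing ∷ Z                 ≡⟨ cong (λ C → O ++ head C ∷ nothing ∷ Z) C₀≡p ⟩
  O ++ just p ∷ nothing ∷ Z                  ≡⟨ ++-assoc O (just p ∷ []) (nothing ∷ Z) ⟨
  (O ++ map just (p ∷ [])) ++ nothing ∷ Z    ≡⟨ cong (λ C → (O ++ map just C) ++ nothing ∷ Z) (trans carried C₀≡p) ⟨
  sweep n [] (layout (gapless (B ∷ Bs))) ++ nothing ∷ Z
    ≡⟨ cong (_++ nothing ∷ Z) (sweep-gapless n [] B Bs rs (stacked-under-[] (B ∷ Bs) st) [] mv) ⟩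
  (blank (length B) ++ layout (settle (B ∷ Bs) 0)) ++ nothing ∷ Z
    ≡⟨ ++-assoc (blank (length B)) _ _ ⟩
  blank (length B) ++ layout (settle (B ∷ Bs) 0) ++ nothing ∷ Z
    ≡⟨ cong (blank (length B) ++_) (layout-settle-∷ʳ B Bs 0 Z) ⟩
  blank (length B) ++ layout (settle (B ∷ Bs) 1) ++ Z ∎)
  where
    open ≡-Reasoning
    C₀ = lastOr B Bs
    O = proj₁ (carry n [] (layout (gapless (B ∷ Bs))))
    carried : proj₂ (carry n [] (layout (gapless (B ∷ Bs)))) ≡ C₀
    carried = carry-gapless n [] (B ∷ Bs) rs (stacked-under-[] (B ∷ Bs) st) [] mv

sweep-perturbed : ∀ n Bs0 l u₁ u₂ U′ Bs3 W → Junction Bs0 (l ∷ []) (u₁ ∷ u₂ ∷ U′) Bs3 →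
  Movable n (concat Bs0) → Movable n (U′ ++ concat Bs3) → WindowRule n l u₁ u₂ W →
  ∃[ a ] sweep n [] (layout (gapless Bs0) ++ map just W ++ map just U′ ++ layout (gapless Bs3))
         ≡ blank a ++ layout (perturbedChain Bs0 l (u₁ ∷ u₂ ∷ U′) Bs3)
sweep-perturbed n Bs0 l u₁ u₂ U′ Bs3 W j mv₀ mv₃ window = proj₁ prefix , (begin
  sweep n [] (layout (gapless Bs0) ++ map just W ++ rest)
    ≡⟨ sweep-++ n [] (layout (gapless Bs0)) _ ⟩
  O ++ sweep n (proj₂ (carry n [] (layout (gapless Bs0)))) (map just W ++ rest)
    ≡⟨ cong (λ C → O ++ sweep n C (map just W ++ rest)) (carry-gapless n [] Bs0 rows₀ (stacked-under-[] Bs0 stacked₀) [] mv₀) ⟩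
  O ++ sweep n C₀ (map just W ++ rest)
    ≡⟨ cong (O ++_) (sweep-++ n C₀ (map just W) rest) ⟩
  O ++ proj₁ (carry n C₀ (map just W)) ++ sweep n (proj₂ (carry n C₀ (map just W))) rest
    ≡⟨ cong (λ r → O ++ proj₁ r ++ sweep n (proj₂ r) rest) (window C₀ L≺last₀) ⟩
  O ++ head C₀ ∷ nothing ∷ just l ∷ sweep n (u₁ ∷ u₂ ∷ []) rest
    ≡⟨ cong (λ Y → O ++ head C₀ ∷ nothing ∷ just l ∷ Y) (sweep-tail n u₁ u₂ U′ Bs3 rowU rows₃ stacked₃ mv₃) ⟩
  O ++ head C₀ ∷ nothing ∷ Z
    ≡⟨ proj₂ prefix ⟩
  blank (proj₁ prefix) ++ layout (settle Bs0 1) ++ Z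
    ≡⟨ cong (blank (proj₁ prefix) ++_) (layout-++ (settle Bs0 1) _) ⟨
  blank (proj₁ prefix) ++ layout (perturbedChain Bs0 l (u₁ ∷ u₂ ∷ U′) Bs3) ∎)
  where
    open ≡-Reasoning
    open Junction j
    rest = map just U′ ++ layout (gapless Bs3)
    O = proj₁ (carry n [] (layout (gapless Bs0)))
    C₀ = lastOr [] Bs0
    Z = layout ((l ∷ [] , length U′) ∷ settle ((u₁ ∷ u₂ ∷ U′) ∷ Bs3) 0)
    prefix = sweep-prefix n l Bs0 rows₀ stacked₀ mv₀ L≺last₀ Z


SingletonJunction : List (List ℕ) → List ℕ → ℕ → ℕ → ℕ → List ℕ → Set
SingletonJunction Bs p l u₁ u₂ s = ∃[ Bs0 ] ∃[ U′ ] ∃[ Bs3 ]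
  (Bs ≡ Bs0 ++ (l ∷ []) ∷ (u₁ ∷ u₂ ∷ U′) ∷ Bs3 × concat Bs0 ≡ p × s ≡ U′ ++ concat Bs3)

record ReadingRows (Bs : List (List ℕ)) : Set where
  field
    rowsOK   : All Row Bs
    stacked  : Stacked Bs
    distinct : Unique (concat Bs)
    movableN : Movable (length (concat Bs)) (concat Bs)

unique-resp-↭ : ∀ {xs ys : List ℕ} → xs ↭ ys → Unique xs → Unique ys
unique-resp-↭ xs↭ys = PermS.Unique-resp-↭ (setoid ℕ) (↭⇒↭ₛ xs↭ys)

movable-↭ : ∀ {w Bs} → ReadingRows Bs → w ↭ concat Bs → Movable (length w) (concat Bs)
movable-↭ {Bs = Bs} R w↭r = subst (λ n → Movable n (concat Bs)) (sym (↭-length w↭r)) (ReadingRows.movableN R)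

steadyStateTime-perturbed : ∀ {w Bs p l u₁ u₂ s W} → ReadingRows Bs → w ↭ concat Bs →
  SingletonJunction Bs p l u₁ u₂ s → WindowRule (length w) l u₁ u₂ W → w ≡ p ++ W ++ s → w ≢ concat Bs →
  SteadyStateTime w 1
steadyStateTime-perturbed {w} {l = l} {u₁} {u₂} {W = W} R w↭r (Bs0 , U′ , Bs3 , refl , refl , refl) window w≡ w≢r =
  steadyStateTime-one w (proj₁ time₁) chain solitons (proj₂ time₁)
    (subst (w ≢_) (sym (cong concat (rows-perturbedChain Bs0 l U Bs3))) w≢r)
  where
    open ReadingRows R
    n = length w
    U = u₁ ∷ u₂ ∷ U′
    chain = perturbedChain Bs0 l U Bs3
    j = junction Bs0 (l ∷ []) U Bs3 rowsOK stacked
    mv = movable-↭ R w↭r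
    mv′ = subst (Movable n) (sym (concat-++ Bs0 ((l ∷ []) ∷ U ∷ Bs3))) mv
    input : map just w ≡ layout (gapless Bs0) ++ map just W ++ map just U′ ++ layout (gapless Bs3)
    input rewrite w≡ | layout-gapless Bs0 | layout-gapless Bs3
      | map-++ just (concat Bs0) (W ++ U′ ++ concat Bs3) | map-++ just W (U′ ++ concat Bs3) | map-++ just U′ (concat Bs3) = refl
    perturbed = sweep-perturbed n Bs0 l u₁ u₂ U′ Bs3 W j (All.++⁻ˡ (concat Bs0) mv′)
                  (All.tail (All.tail (All.tail (All.++⁻ʳ (concat Bs0) mv′)))) window
    time₁ : ∃[ a ] stateAt w 1 ≡ blank a ++ layout chain
    time₁ = proj₁ perturbed , (begin
      bbsMove n (map just w)
        ≡⟨ bbsMove-sweep n (map just w) (subst Unique (sym (mapMaybe-just w)) (unique-resp-↭ (↭-sym w↭r) distinct)) ⟩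
      sweep n [] (map just w) ≡⟨ cong (sweep n []) input ⟩
      sweep n [] (layout (gapless Bs0) ++ map just W ++ map just U′ ++ layout (gapless Bs3)) ≡⟨ proj₂ perturbed ⟩
      blank (proj₁ perturbed) ++ layout chain ∎)
      where open ≡-Reasoning
    solitons : Solitons n chain
    solitons = record
      { steady        = steady-perturbedChain j
      ; movableBalls  = subst (Movable n ∘ concat) (sym (rows-perturbedChain Bs0 l U Bs3)) mv
      ; distinctBalls = subst (Unique ∘ concat) (sym (rows-perturbedChain Bs0 l U Bs3)) distinct
      }

-- Knuth moves on a reading word

split-descent : ∀ B R p {a b t} → Linked _<_ B → b < a → B ++ R ≡ p ++ a ∷ b ∷ t →
  (∃[ p′ ] (p ≡ B ++ p′ × R ≡ p′ ++ a ∷ b ∷ t)) ⊎ (B ≡ p ++ a ∷ [] × R ≡ b ∷ t)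
split-descent [] R p _ _ eq = inj₁ (p , refl , eq)
split-descent (x ∷ []) R [] _ _ eq with ∷-injective eq
... | refl , R≡ = inj₂ (refl , R≡)
split-descent (x ∷ y ∷ B) R [] (x<y ∷ _) b<a eq with ∷-injective eq
... | refl , e with ∷-injective e
...   | refl , _ = ⊥-elim (<-asym x<y b<a)
split-descent (x ∷ B) R (q ∷ p) l b<a eq with ∷-injective eq
... | refl , e with split-descent B R p (Linked.tail l) b<a e
...   | inj₁ (p′ , p≡ , R≡) = inj₁ (p′ , cong (x ∷_) p≡ , R≡)
...   | inj₂ (B≡ , R≡) = inj₂ (cong (x ∷_) B≡ , R≡)

concat-first-row : ∀ Bs {b t} → All Row Bs → concat Bs ≡ b ∷ t →
  ∃[ U1 ] ∃[ Bs3 ] (Bs ≡ (b ∷ U1) ∷ Bs3 × t ≡ U1 ++ concat Bs3)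
concat-first-row ([] ∷ Bs) ((() , _) ∷ _) _
concat-first-row ((x ∷ U) ∷ Bs) _ eq with ∷-injective eq
... | refl , e = U , Bs , refl , sym e

descent-junction : ∀ Bs p {a b t} → All Row Bs → b < a → concat Bs ≡ p ++ a ∷ b ∷ t →
  ∃[ Bs0 ] ∃[ L0 ] ∃[ U1 ] ∃[ Bs3 ]
    (Bs ≡ Bs0 ++ (L0 ++ a ∷ []) ∷ (b ∷ U1) ∷ Bs3 × concat Bs0 ++ L0 ≡ p × t ≡ U1 ++ concat Bs3)
descent-junction [] [] _ _ ()
descent-junction [] (_ ∷ _) _ _ ()
descent-junction (B ∷ Bs) p (r ∷ rs) b<a eq with split-descent B (concat Bs) p (proj₂ r) b<a eq
... | inj₂ (refl , R≡) with concat-first-row Bs rs R≡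
...   | U1 , Bs3 , refl , t≡ = [] , p , U1 , Bs3 , refl , refl , t≡
descent-junction (B ∷ Bs) p (r ∷ rs) b<a eq | inj₁ (p′ , refl , R≡) with descent-junction Bs p′ rs b<a R≡
...   | Bs0 , L0 , U1 , Bs3 , refl , refl , t≡ = B ∷ Bs0 , L0 , U1 , Bs3 , refl , ++-assoc B (concat Bs0) L0 , t≡

above-all : ∀ {v V} L → Linked _<_ L → ColStrict (v ∷ V) L → All (v <_) L
above-all [] _ _ = []
above-all (x ∷ L) l (v<x , _) = v<x ∷ All.map (<-trans v<x) (first<rest L l)

colStrict-first<last : ∀ {z U} M y → Linked _<_ (M ++ y ∷ []) → ColStrict (z ∷ U) (M ++ y ∷ []) → z < y
colStrict-first<last [] y _ (z<y , _) = z<y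
colStrict-first<last (h ∷ M) y l (z<h , _) = <-trans z<h (All.head (All.++⁻ʳ M (first<rest (M ++ y ∷ []) l)))

split-last : ∀ (X : List ℕ) {x} Y p {a} → X ++ x ∷ Y ≡ p ++ a ∷ [] → ∃[ p′ ] (p ≡ X ++ p′ × x ∷ Y ≡ p′ ++ a ∷ [])
split-last [] Y p eq = p , refl , eq
split-last (x′ ∷ []) Y [] eq with ∷-injective eq
... | _ , ()
split-last (x′ ∷ x″ ∷ X) Y [] eq with ∷-injective eq
... | _ , ()
split-last (x′ ∷ X) Y (q ∷ p) eq with ∷-injective eq
... | refl , e with split-last X Y p e
...   | p′ , refl , Y≡ = p′ , refl , Y≡

under-last-row : ∀ Bs0 p {y z} → All Row Bs0 → concat Bs0 ≡ p ++ y ∷ [] → ColStrict (z ∷ []) (lastOr [] Bs0) → z < y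
under-last-row [] [] _ () _
under-last-row [] (_ ∷ _) _ () _
under-last-row (B ∷ []) p {y} (r ∷ []) eq z≺B =
  colStrict-first<last p y (subst (Linked _<_) B≡ (proj₂ r)) (subst (ColStrict _) B≡ z≺B)
  where B≡ = trans (sym (++-identityʳ B)) eq
under-last-row (B ∷ [] ∷ Bs) p (_ ∷ (() , _) ∷ _) _ _
under-last-row (B ∷ (b′ ∷ B′) ∷ Bs) p (_ ∷ rs) eq z≺last =
  under-last-row ((b′ ∷ B′) ∷ Bs) (proj₁ split) rs (proj₂ (proj₂ split)) z≺last
  where split = split-last B (B′ ++ concat Bs) p eq

second-in-row : ∀ {Bs0 L b U1 Bs3 c s} → Junction Bs0 L (b ∷ U1) Bs3 → b < c → c ∷ s ≡ U1 ++ concat Bs3 →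
  ∃[ U′ ] (U1 ≡ c ∷ U′ × s ≡ U′ ++ concat Bs3)
second-in-row {U1 = []} {Bs3} j b<c eq with concat-first-row Bs3 (Junction.rows₃ j) (sym eq) | Junction.stacked₃ j
... | _ , _ , refl , _ | (c<b , _) ∷ _ = ⊥-elim (<-asym b<c c<b)
second-in-row {U1 = c′ ∷ U′} j _ eq with ∷-injective eq
... | refl , s≡ = U′ , refl , s≡

linked-suffix : ∀ A {B} → Linked _<_ (A ++ B) → Linked _<_ B
linked-suffix [] l = l
linked-suffix (a ∷ A) l = linked-suffix A (Linked.tail l)

colStrict-second<last : ∀ {x u U} A {q z} → Linked _<_ ((A ++ q ∷ []) ++ z ∷ []) →
  ColStrict (x ∷ u ∷ U) ((A ++ q ∷ []) ++ z ∷ []) → u < z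
colStrict-second<last [] _ (_ , u<z , _) = u<z
colStrict-second<last (a ∷ A) {q} {z} l (_ , c) = colStrict-first<last (A ++ q ∷ []) z (Linked.tail l) c

¬colStrict-[] : ∀ A {q} → ¬ ColStrict [] (A ++ q ∷ [])
¬colStrict-[] [] ()
¬colStrict-[] (a ∷ A) ()

¬colStrict-singleton : ∀ {x} A {q z} → ¬ ColStrict (x ∷ []) ((A ++ q ∷ []) ++ z ∷ [])
¬colStrict-singleton [] (_ , ())
¬colStrict-singleton (a ∷ A) {q} (_ , c) = ¬colStrict-[] (A ++ q ∷ []) c

++-∷ʳ-++ : ∀ (A B : List ℕ) q X → (A ++ (B ++ q ∷ [])) ++ X ≡ (A ++ B) ++ q ∷ X
++-∷ʳ-++ A B q X = trans (cong (_++ X) (sym (++-assoc A B (q ∷ [])))) (++-assoc (A ++ B) (q ∷ []) X)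

k1-from-reading-junction : ∀ Bs p {x y z s} → All Row Bs → Stacked Bs → x < y → y < z →
  concat Bs ≡ p ++ y ∷ x ∷ z ∷ s → SingletonJunction Bs p y x z s
k1-from-reading-junction Bs p {x} {y} {z} rs st x<y y<z eq with descent-junction Bs p rs x<y eq
... | Bs0 , L0 , U1 , Bs3 , refl , refl , t≡ with second-in-row (junction Bs0 _ _ Bs3 rs st) (<-trans x<y y<z) t≡
...   | U′ , refl , s≡ = singleton L0 (junction Bs0 _ _ Bs3 rs st)
  where
    singleton : ∀ L0 → Junction Bs0 (L0 ++ y ∷ []) (x ∷ z ∷ U′) Bs3 →
      SingletonJunction (Bs0 ++ (L0 ++ y ∷ []) ∷ (x ∷ z ∷ U′) ∷ Bs3) (concat Bs0 ++ L0) y x z _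
    singleton [] _ = Bs0 , U′ , Bs3 , refl , sym (++-identityʳ (concat Bs0)) , s≡
    singleton (q ∷ L0′) j =
      ⊥-elim (<-asym y<z (colStrict-first<last L0′ y (Linked.tail (proj₂ (Junction.rowL j))) (proj₂ (Junction.U≺L j))))

k2-to-reading-junction : ∀ Bs p {x y z s w} → All Row Bs → Stacked Bs → x < y → y < z →
  concat Bs ≡ p ++ z ∷ x ∷ y ∷ s → w ≡ p ++ x ∷ z ∷ y ∷ s → ¬ KB (concat Bs) w → SingletonJunction Bs p z x y s
k2-to-reading-junction Bs p {x} {y} {z} {s} rs st x<y y<z eq w≡ notKB with descent-junction Bs p rs (<-trans x<y y<z) eq
... | Bs0 , L0 , U1 , Bs3 , refl , refl , t≡ with second-in-row (junction Bs0 _ _ Bs3 rs st) x<y t≡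
...   | U′ , refl , s≡ with initLast L0
...     | [] = Bs0 , U′ , Bs3 , refl , sym (++-identityʳ (concat Bs0)) , s≡
...     | L0′ ∷ʳ′ q = ⊥-elim (notKB (inj₂ (concat Bs0 ++ L0′ , s , x , q , y , z , x<q , q<z , x<y , y<z ,
                        trans w≡ (++-∷ʳ-++ (concat Bs0) L0′ q _) , trans eq (++-∷ʳ-++ (concat Bs0) L0′ q _))))
  where
    j = junction Bs0 ((L0′ ++ q ∷ []) ++ z ∷ []) (x ∷ y ∷ U′) Bs3 rs st
    L-increasing = proj₂ (Junction.rowL j)
    x<q : x < q
    x<q = All.head (All.++⁻ʳ L0′ (All.++⁻ˡ (L0′ ++ q ∷ []) (above-all _ L-increasing (Junction.U≺L j))))
    q<z : q < z
    q<z = Linked.head (linked-suffix L0′ (subst (Linked _<_) (++-assoc L0′ (q ∷ []) (z ∷ [])) L-increasing))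

k1-to-reading-isKB : ∀ {Bs w} → All Row Bs → Stacked Bs → K1step w (concat Bs) → KB (concat Bs) w
k1-to-reading-isKB {Bs} rs st (p , s , x , y , z , x<y , y<z , w≡ , eq)
  with descent-junction Bs (p ++ y ∷ []) rs (<-trans x<y y<z) (trans eq (sym (++-assoc p (y ∷ []) _)))
... | Bs0 , L0 , U1 , Bs3 , refl , pe , t≡ with initLast L0
...   | [] = ⊥-elim (<-asym y<z (under-last-row Bs0 p (Junction.rows₀ j) (trans (sym (++-identityʳ _)) pe) (Junction.L≺last₀ j)))
  where j = junction Bs0 _ _ Bs3 rs st
k1-to-reading-isKB rs st (p , _ , x , y , z , x<y , y<z , w≡ , eq) | Bs0 , _ , [] , Bs3 , refl , _ , _ | L0′ ∷ʳ′ q =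
  ⊥-elim (¬colStrict-singleton L0′ (Junction.U≺L (junction Bs0 _ _ Bs3 rs st)))
k1-to-reading-isKB rs st (p , _ , x , y , z , x<y , y<z , w≡ , eq) | Bs0 , _ , u₂ ∷ U′ , Bs3 , refl , _ , refl | L0′ ∷ʳ′ q =
  inj₂ (p , U′ ++ concat Bs3 , x , y , u₂ , z , x<y , y<z , x<u₂ , u₂<z , w≡ , eq)
  where
    j = junction Bs0 ((L0′ ++ q ∷ []) ++ z ∷ []) (x ∷ u₂ ∷ U′) Bs3 rs st
    x<u₂ = Linked.head (proj₂ (Junction.rowU j))
    u₂<z = colStrict-second<last L0′ (proj₂ (Junction.rowL j)) (Junction.U≺L j)

k2-from-reading-impossible : ∀ {Bs w} → All Row Bs → Stacked Bs → ¬ K2step (concat Bs) w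
k2-from-reading-impossible {Bs} rs st (p , s , x , y , z , x<y , y<z , eq , _)
  with descent-junction Bs (p ++ x ∷ []) rs y<z (trans eq (sym (++-assoc p (x ∷ []) _)))
... | Bs0 , L0 , U1 , Bs3 , refl , pe , _ with initLast L0
...   | [] = <-asym (<-trans x<y y<z) (under-last-row Bs0 p (Junction.rows₀ j) (trans (sym (++-identityʳ _)) pe) (Junction.L≺last₀ j))
  where j = junction Bs0 _ _ Bs3 rs st
...   | L0′ ∷ʳ′ q with ∷ʳ-injective (concat Bs0 ++ L0′) p (trans (++-assoc (concat Bs0) L0′ (q ∷ [])) pe)
...     | _ , refl = <-asym x<y y<x
  where
    j = junction Bs0 ((L0′ ++ q ∷ []) ++ z ∷ []) (y ∷ U1) Bs3 rs st
    y<x = All.head (All.++⁻ʳ L0′ (All.++⁻ˡ (L0′ ++ q ∷ []) (above-all _ (proj₂ (Junction.rowL j)) (Junction.U≺L j))))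

-- The standard tableau

stacked-reverseAcc : ∀ R T acc → ColsOK (R ∷ T) → Stacked (R ∷ acc) → Stacked (reverseAcc (R ∷ acc) T)
stacked-reverseAcc R [] acc _ st = st
stacked-reverseAcc R (R′ ∷ T) acc (R′≺R , cols) st = stacked-reverseAcc R′ T (R ∷ acc) cols (R′≺R ∷ st)

stacked-reverse : ∀ T → ColsOK T → Stacked (reverse T)
stacked-reverse [] _ = []
stacked-reverse (R ∷ T) cols = stacked-reverseAcc R T [] cols [-]

concat-reverse-↭ : ∀ (T : List (List ℕ)) → concat (reverse T) ↭ concat T
concat-reverse-↭ [] = ↭-refl
concat-reverse-↭ (R ∷ T) = begin
  concat (reverse (R ∷ T))         ≡⟨ cong concat (unfold-reverse R T) ⟩
  concat (reverse T ++ R ∷ [])     ≡⟨ concat-++ (reverse T) (R ∷ []) ⟨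
  concat (reverse T) ++ R ++ []    ≡⟨ cong (concat (reverse T) ++_) (++-identityʳ R) ⟩
  concat (reverse T) ++ R          ↭⟨ ++⁺ʳ R (concat-reverse-↭ T) ⟩
  concat T ++ R                    ↭⟨ ++-comm (concat T) R ⟩
  R ++ concat T                    ∎
  where open PermutationReasoning

tableau-readingRows : ∀ T → StandardTableau T → ReadingRows (reverse T)
tableau-readingRows T st = record
  { rowsOK   = All-resp-↭ (↭-sym (↭-reverse T)) (All.zip (rowsNonEmpty , rowsIncr))
  ; stacked  = stacked-reverse T colsIncr
  ; distinct = unique-resp-↭ (↭-sym r↭oneTo) (Unique.map⁺ suc-injective (Unique.upTo⁺ N))
  ; movableN = subst (λ n → Movable n (concat (reverse T))) (sym (↭-length (concat-reverse-↭ T)))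
                 (All-resp-↭ (↭-sym r↭oneTo) (All.map⁺ (All.applyUpTo⁺₁ id N <ᵇ-true)))
  }
  where
    open StandardTableau st
    N = length (concat T)
    r↭oneTo : concat (reverse T) ↭ oneTo N
    r↭oneTo = ↭-trans (concat-reverse-↭ T) entries

movable-window : ∀ {w Bs} → ReadingRows Bs → w ↭ concat Bs → ∀ p W {s} → w ≡ p ++ W ++ s → Movable (length w) W
movable-window R w↭r p W w≡ = All.++⁻ˡ W (All.++⁻ʳ p (subst (Movable _) w≡ (All-resp-↭ (↭-sym w↭r) (movable-↭ R w↭r))))

k1-from-reading-steadyStateTime : ∀ {Bs w} → ReadingRows Bs → K1step (concat Bs) w → SteadyStateTime w 1
k1-from-reading-steadyStateTime {Bs} {w} R (p , s , x , y , z , x<y , y<z , r≡ , w≡) =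
  steadyStateTime-perturbed R w↭r (k1-from-reading-junction Bs p rowsOK stacked x<y y<z r≡)
    (k1-window x<y y<z (movable-window R w↭r p (y ∷ z ∷ x ∷ []) w≡)) w≡ w≢r
  where
    open ReadingRows R
    w↭r : w ↭ concat Bs
    w↭r = subst₂ _↭_ (sym w≡) (sym r≡) (++⁺ˡ p (↭-prep y (↭-swap z x ↭-refl)))
    w≢r : w ≢ concat Bs
    w≢r w≡r = <-irrefl (sym (∷-injectiveˡ (∷-injectiveʳ (++-cancelˡ p _ _ (trans (sym w≡) (trans w≡r r≡)))))) (<-trans x<y y<z)

k2-to-reading-steadyStateTime : ∀ {Bs w} → ReadingRows Bs → K2step w (concat Bs) → ¬ KB (concat Bs) w → SteadyStateTime w 1
k2-to-reading-steadyStateTime {Bs} {w} R (p , s , x , y , z , x<y , y<z , w≡ , r≡) notKB =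
  steadyStateTime-perturbed R w↭r (k2-to-reading-junction Bs p rowsOK stacked x<y y<z r≡ w≡ notKB)
    (k2-window x<y y<z (movable-window R w↭r p (x ∷ z ∷ y ∷ []) w≡)) w≡ w≢r
  where
    open ReadingRows R
    w↭r : w ↭ concat Bs
    w↭r = subst₂ _↭_ (sym w≡) (sym r≡) (++⁺ˡ p (↭-swap x z ↭-refl))
    w≢r : w ≢ concat Bs
    w≢r w≡r = <-irrefl (∷-injectiveˡ (++-cancelˡ p _ _ (trans (sym w≡) (trans w≡r r≡)))) (<-trans x<y y<z)

theorem7p4 : (T : List (List ℕ)) → StandardTableau T → (w : List ℕ) →
    ProperK1 (rowReading T) w ⊎ ProperK2 (rowReading T) w →
    SteadyStateTime w 1
theorem7p4 T st w (inj₁ (inj₁ r→w , _)) = k1-from-reading-steadyStateTime (tableau-readingRows T st) r→w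
theorem7p4 T st w (inj₁ (inj₂ w→r , notKB)) = ⊥-elim (notKB (k1-to-reading-isKB rowsOK stacked w→r))
  where open ReadingRows (tableau-readingRows T st)
theorem7p4 T st w (inj₂ (inj₁ r→w , _)) = ⊥-elim (k2-from-reading-impossible rowsOK stacked r→w)
  where open ReadingRows (tableau-readingRows T st)
theorem7p4 T st w (inj₂ (inj₂ w→r , notKB)) = k2-to-reading-steadyStateTime (tableau-readingRows T st) w→r notKB
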